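{- Let $P'$ and $P''$ be multipartite partial orders on a finite set $D$. Then there exist distinct $a,b\in D$ such that $a$ and $b$ are comparable in $P'$ and comparable in $P''$ (not necessarily in the same direction).
   Context: A partial order $\preceq$ on $D$ is multipartite if there is a partition $D=D_1\cup\dots\cup D_t$ with $t\ge2$ (nonempty classes) such that $d\preceq d'$ holds iff $d=d'$ or $d\in D_i$ and $d'\in D_j$ for some $1\le i<j\le t$. -}

module Defs where

open import Level using (0ℓ)
open import Data.Nat using (ℕ; _≤_)
open import Data.Fin using (Fin; _<_)
open import Data.Product using (Σ; ∃; _×_; _,_)
open import Data.Sum using (_⊎_)
open import Function.Bundles using (_⇔_)
open import Relation.Binary.Core using (Rel)
open import Relation.Binary.Structures using (IsPartialOrder)
open import Relation.Binary.PropositionalEquality using (_≡_)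

-- A partition of D into t nonempty classes D_1,...,D_t is given by a
-- surjective class map  cls : D → Fin t  (class D_i = cls⁻¹(i)), the classes
-- being ordered by the order on Fin t.
Surjective : {A B : Set} → (A → B) → Set
Surjective {A} {B} f = (b : B) → Σ A (λ a → f a ≡ b)

IsMultipartite : {D : Set} → Rel D 0ℓ → Set
IsMultipartite {D} _≼_ =
  IsPartialOrder _≡_ _≼_ ×
  Σ ℕ (λ t → 2 ≤ t ×
    Σ (D → Fin t) (λ cls → Surjective cls ×
      ((d d' : D) → (d ≼ d') ⇔ (d ≡ d' ⊎ cls d < cls d'))))

Comparable : {D : Set} → Rel D 0ℓ → D → D → Set
Comparable _≼_ a b = a ≼ b ⊎ b ≼ a

{-# OPTIONS --safe #-}
-- The class map of a multipartite order is non-constant, and elements in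
-- different classes are comparable; so it suffices to find a, b separated by
-- both class maps f and g. Take a, b with f a ≢ f b. If g a ≡ g b, pick x with
-- g x ≢ g a; then x is separated from a or from b by f, and by g from both.
module Submission where

open import Defs
open import Level using (0ℓ)
open import Data.Nat using (ℕ; s≤s; z≤n) renaming (_≤_ to _≤ℕ_)
open import Data.Fin using (Fin; zero; suc; _<_)
open import Data.Fin.Properties using (_≟_; <-cmp)
open import Data.Product using (Σ; ∃; ∃₂; _×_; _,_)
open import Data.Sum using (_⊎_; inj₁; inj₂)
open import Function.Bundles using (_⇔_; module Equivalence)
open import Relation.Binary.Core using (Rel)
open import Relation.Binary.Definitions using (DecidableEquality; tri<; tri≈; tri>)
open import Relation.Binary.PropositionalEquality using (_≡_; _≢_; sym; trans; cong)
open import Relation.Nullary using (¬_; yes; no; contradiction)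

NonConstant : {A B : Set} → (A → B) → Set
NonConstant f = ∃₂ λ a b → f a ≢ f b

nonConstant⇒∃-differing : {A B : Set} {f : A → B} → DecidableEquality B →
                          NonConstant f → (a : A) → ∃ λ x → f x ≢ f a
nonConstant⇒∃-differing {f = f} _≟B_ (c , d , fc≢fd) a with f c ≟B f a
... | yes fc≡fa = d , λ fd≡fa → fc≢fd (trans fc≡fa (sym fd≡fa))
... | no  fc≢fa = c , fc≢fa

nonConstant-separate : {A B C : Set} {f : A → B} {g : A → C} →
                       DecidableEquality B → DecidableEquality C →
                       NonConstant f → NonConstant g →
                       ∃₂ λ a b → f a ≢ f b × g a ≢ g b
nonConstant-separate {f = f} {g} _≟B_ _≟C_ (a , b , fa≢fb) ncg with g a ≟C g b
... | no  ga≢gb = a , b , fa≢fb , ga≢gb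
... | yes ga≡gb with nonConstant⇒∃-differing _≟C_ ncg a
...   | x , gx≢ga with f x ≟B f a
...     | no  fx≢fa = x , a , fx≢fa , gx≢ga
...     | yes fx≡fa = x , b , (λ fx≡fb → fa≢fb (trans (sym fx≡fa) fx≡fb))
                            , (λ gx≡gb → gx≢ga (trans gx≡gb (sym ga≡gb)))

surjective⇒nonConstant : {D : Set} {t : ℕ} {cls : D → Fin t} →
                         2 ≤ℕ t → Surjective cls → NonConstant cls
surjective⇒nonConstant (s≤s (s≤s z≤n)) surj
  with surj zero | surj (suc zero)
... | a , cls-a≡0 | b , cls-b≡1 = a , b , λ cls-a≡cls-b →
  contradiction (trans (sym cls-a≡0) (trans cls-a≡cls-b cls-b≡1)) λ ()

differentClasses⇒comparable : {D : Set} {t : ℕ} {_≼_ : Rel D 0ℓ} (cls : D → Fin t) →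
                              (∀ d d' → (d ≼ d') ⇔ (d ≡ d' ⊎ cls d < cls d')) →
                              {a b : D} → cls a ≢ cls b → Comparable _≼_ a b
differentClasses⇒comparable cls ≼⇔ {a} {b} cls-a≢cls-b with <-cmp (cls a) (cls b)
... | tri< a<b _ _ = inj₁ (Equivalence.from (≼⇔ a b) (inj₂ a<b))
... | tri≈ _ a≡b _ = contradiction a≡b cls-a≢cls-b
... | tri> _ _ b<a = inj₂ (Equivalence.from (≼⇔ b a) (inj₂ b<a))

multipartite⇒classMap : {D : Set} {_≼_ : Rel D 0ℓ} → IsMultipartite _≼_ →
                        Σ ℕ λ t → Σ (D → Fin t) λ cls → NonConstant cls ×
                          (∀ {a b} → cls a ≢ cls b → Comparable _≼_ a b)
multipartite⇒classMap (_ , t , 2≤t , cls , surj , ≼⇔) =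
  t , cls , surjective⇒nonConstant 2≤t surj , differentClasses⇒comparable cls ≼⇔

lemmaA4 : (n : ℕ) (P′ P″ : Rel (Fin n) 0ℓ) →
          IsMultipartite P′ → IsMultipartite P″ →
          Σ (Fin n) (λ a → Σ (Fin n) (λ b →
            ¬ (a ≡ b) × Comparable P′ a b × Comparable P″ a b))
lemmaA4 n P′ P″ mp′ mp″
  with multipartite⇒classMap mp′ | multipartite⇒classMap mp″
... | _ , cls′ , nc′ , comparable′ | _ , cls″ , nc″ , comparable″
  with nonConstant-separate _≟_ _≟_ nc′ nc″
...   | a , b , cls′≢ , cls″≢ =
  a , b , (λ a≡b → cls′≢ (cong cls′ a≡b)) , comparable′ cls′≢ , comparable″ cls″≢
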